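{- Let $n \geq 8$. Then $\Psi(M_0) \geq \lfloor n/4 \rfloor - 1$; that is, there exist at least $\lfloor n/4\rfloor - 1$ pairwise disjoint sets, each consisting of $2n+1$ linearly independent columns of $M_0$.
   Context: For $1 \le i,j \le n$ let $\mathbf{c}_{i,j} \in \mathbb{R}^{2n+1}$ be the vector whose $k$-th coordinate ($1\le k\le n$) is $1$ if $k=i$ and $0$ otherwise, whose $(n+k)$-th coordinate ($1 \le k \le n-1$) is $1$ if $k=j$ and $0$ otherwise, whose $2n$-th coordinate is $1$ if $i=j$ and $0$ otherwise, and whose $(2n+1)$-th coordinate is $1$ if $i+j=n+1$ and $0$ otherwise. $M_0$ is the $(2n+1)\times n^2$ matrix whose $((i-1)n+j)$-th column is $\mathbf{c}_{i,j}$. $\Psi(M_0)$ is the largest integer $T$ such that there exist sets $\mathfrak{D}_1,\dots,\mathfrak{D}_T$, each a linearly independent set of $2n+1$ columns of $M_0$, with $\mathfrak{D}_i\cap\mathfrak{D}_j=\emptyset$ for $i\neq j$.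
   Formalization: The columns of $M_0$ have rational entries, and their linear independence is taken over ℚ rather than ℝ. -}

module Defs where

open import Data.Nat using (ℕ; zero; suc; _≡ᵇ_; _<ᵇ_; _∸_) renaming (_+_ to _+ℕ_)
open import Data.Fin using (Fin; toℕ; zero; suc)
open import Data.Product using (_×_; _,_)
open import Data.Bool using (Bool; true; false; if_then_else_)
open import Data.Rational using (ℚ; 0ℚ; 1ℚ; _+_; _*_)
open import Relation.Binary.PropositionalEquality using (_≡_)

𝟙 : Bool → ℚ
𝟙 b = if b then 1ℚ else 0ℚ

Σ : (m : ℕ) → (Fin m → ℚ) → ℚ
Σ zero    f = 0ℚ
Σ (suc m) f = f zero + Σ m (λ a → f (suc a))

-- Column indices of M₀: pairs (i , j) with i, j ∈ Fin n, 0-indexed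
-- (paper's (i,j) with 1 ≤ i,j ≤ n corresponds to (i-1 , j-1); paper's column
-- number (i-1)n+j is in bijection with such pairs).
ColIdx : ℕ → Set
ColIdx n = Fin n × Fin n

-- The column c_{i,j} ∈ ℚ^{2n+1}, coordinates 0-indexed (paper's coordinate k is our k-1):
--   coordinates 0 .. n-1       : 1 iff coordinate = i
--   coordinates n .. 2n-2      : 1 iff coordinate - n = j
--   coordinate  2n-1           : 1 iff i = j
--   coordinate  2n             : 1 iff i + j = n - 1   (paper: i + j = n + 1, 1-indexed)
col : (n : ℕ) → ColIdx n → Fin (suc (n +ℕ n)) → ℚ
col n (i , j) k =
  let kk = toℕ k ; i' = toℕ i ; j' = toℕ j in
  if kk <ᵇ n then 𝟙 (kk ≡ᵇ i')
  else if kk <ᵇ (n +ℕ (n ∸ 1)) then 𝟙 ((kk ∸ n) ≡ᵇ j')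
  else if kk ≡ᵇ (n +ℕ (n ∸ 1)) then 𝟙 (i' ≡ᵇ j')
  else 𝟙 ((i' +ℕ j') ≡ᵇ (n ∸ 1))

M₀ : (n : ℕ) → Fin (suc (n +ℕ n)) → ColIdx n → ℚ
M₀ n k c = col n c k

LinIndep : {m d : ℕ} → (Fin m → Fin d → ℚ) → Set
LinIndep {m} {d} v =
  (c : Fin m → ℚ) → (∀ k → Σ m (λ a → c a * v a k) ≡ 0ℚ) → ∀ a → c a ≡ 0ℚ

{-# OPTIONS --safe #-}
module Submission where

-- Write n = m + 1.  M₀ is the incidence matrix between the cells of the n × n grid and 2n + 1
-- of its lines: all rows, the first m columns, the diagonal and the antidiagonal.  For
-- 4t + 5 ≤ m put A = 2t + 1 and B = 2t + 2, and choose one cell on every line: (A , m) and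
-- (B , m) for rows A and B, (B , A) and (A , B) for columns A and B, (A , A) for the diagonal,
-- (A , m - A) for the antidiagonal, and for any other row (column) a cell in column (row) A
-- or B, picked by parity and off the antidiagonal.  Ranking the lines
--   diagonal < antidiagonal < other rows and columns < columns A, B < rows A, B,
-- each chosen cell lies on its own line and otherwise only on lines of higher rank, so the
-- chosen columns of M₀ form a unitriangular matrix.  For disjointness, charge a cell (i , j)
-- to block ⌈i/2⌉ if 2i ≤ m and, when also 2j ≤ m, i and j have the same parity, and to block
-- ⌈j/2⌉ otherwise: the parity choices make every cell chosen for t charged to
-- ⌈A/2⌉ = ⌈B/2⌉ = t + 1.

open import Defs
open import Data.Bool using (Bool; true; false; T; if_then_else_)
open import Data.Empty using (⊥-elim)
open import Data.Fin as Fin using (Fin; toℕ; fromℕ<)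
import Data.Fin.Properties as Finᴾ
open import Data.Nat
  using (ℕ; zero; suc; _+_; _*_; _∸_; _/_; _≤_; _<_; _≡ᵇ_; _<ᵇ_; z≤n; s≤s; s≤s⁻¹; parity; ⌈_/2⌉)
open import Data.Nat.DivMod using (m/n*n≤m)
open import Data.Nat.Induction using (<-wellFounded)
open import Data.Nat.Properties
open import Data.Nat.Tactic.RingSolver using (solve-∀)
open import Data.Parity.Base using (Parity; 0ℙ; 1ℙ; _⁻¹)
open import Data.Parity.Properties using (p≢p⁻¹) renaming (_≟_ to _≟ᵖ_)
open import Data.Product using (Σ-syntax; _×_; _,_; proj₁; proj₂; map)
open import Data.Rational as ℚ using (ℚ; 0ℚ; 1ℚ)
import Data.Rational.Properties as ℚᴾ
open import Data.Sum using (_⊎_; inj₁; inj₂)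
open import Data.Unit using (⊤; tt)
open import Function using (_on_; _∘_)
open import Function.Definitions using (Injective)
open import Induction.WellFounded using (Acc; acc)
open import Relation.Binary.PropositionalEquality
open import Relation.Nullary using (¬_; Dec; yes; no; _⊎-dec_; _×-dec_; _→-dec_)
open import Relation.Nullary.Reflects using (Reflects; ofʸ; ofⁿ; fromEquivalence)
import Relation.Binary.Construct.On as On

Σ-zero : ∀ m (f : Fin m → ℚ) → (∀ a → f a ≡ 0ℚ) → Σ m f ≡ 0ℚ
Σ-zero zero    f f≡0 = refl
Σ-zero (suc m) f f≡0 = cong₂ ℚ._+_ (f≡0 Fin.zero) (Σ-zero m (f ∘ Fin.suc) (f≡0 ∘ Fin.suc))

Σ-single : ∀ m (f : Fin m → ℚ) a → (∀ b → b ≢ a → f b ≡ 0ℚ) → Σ m f ≡ f a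
Σ-single (suc m) f Fin.zero others≡0 = begin
  f Fin.zero ℚ.+ Σ m (f ∘ Fin.suc)  ≡⟨ cong (f Fin.zero ℚ.+_) (Σ-zero m (f ∘ Fin.suc) tail≡0) ⟩
  f Fin.zero ℚ.+ 0ℚ                 ≡⟨ ℚᴾ.+-identityʳ (f Fin.zero) ⟩
  f Fin.zero                        ∎
  where
  open ≡-Reasoning
  tail≡0 : ∀ b → f (Fin.suc b) ≡ 0ℚ
  tail≡0 b = others≡0 (Fin.suc b) λ ()
Σ-single (suc m) f (Fin.suc a) others≡0 = begin
  f Fin.zero ℚ.+ Σ m (f ∘ Fin.suc)  ≡⟨ cong (ℚ._+ Σ m (f ∘ Fin.suc)) (others≡0 Fin.zero λ ()) ⟩
  0ℚ ℚ.+ Σ m (f ∘ Fin.suc)          ≡⟨ ℚᴾ.+-identityˡ _ ⟩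
  Σ m (f ∘ Fin.suc)                 ≡⟨ Σ-single m (f ∘ Fin.suc) a others≡0′ ⟩
  f (Fin.suc a)                     ∎
  where
  open ≡-Reasoning
  others≡0′ : ∀ b → b ≢ a → f (Fin.suc b) ≡ 0ℚ
  others≡0′ b b≢a = others≡0 (Fin.suc b) (b≢a ∘ Finᴾ.suc-injective)

record Unitriangular {d : ℕ} (v : Fin d → Fin d → ℚ) : Set where
  field
    rank            : Fin d → ℕ
    one-on-diagonal : ∀ a → v a a ≡ 1ℚ
    triangular      : ∀ a b → b ≢ a → v b a ≡ 0ℚ ⊎ rank b < rank a

module _ {d : ℕ} {v : Fin d → Fin d → ℚ} (U : Unitriangular v) where
  open Unitriangular U

  Unitriangular⇒LinIndep : LinIndep v
  Unitriangular⇒LinIndep c combination≡0 a = vanish a (On.wellFounded rank <-wellFounded a)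
    where
    open ≡-Reasoning
    vanish : ∀ a → Acc (_<_ on rank) a → c a ≡ 0ℚ
    vanish a (acc lower) = begin
      c a                          ≡⟨ sym (ℚᴾ.*-identityʳ (c a)) ⟩
      c a ℚ.* 1ℚ                   ≡⟨ cong (c a ℚ.*_) (sym (one-on-diagonal a)) ⟩
      c a ℚ.* v a a                ≡⟨ sym (Σ-single d (λ b → c b ℚ.* v b a) a others-vanish) ⟩
      Σ d (λ b → c b ℚ.* v b a)    ≡⟨ combination≡0 a ⟩
      0ℚ                           ∎
      where
      others-vanish : ∀ b → b ≢ a → c b ℚ.* v b a ≡ 0ℚ
      others-vanish b b≢a with triangular a b b≢a
      ... | inj₁ vba≡0 = trans (cong (c b ℚ.*_) vba≡0) (ℚᴾ.*-zeroʳ (c b))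
      ... | inj₂ rb<ra = trans (cong (ℚ._* v b a) (vanish b (lower rb<ra))) (ℚᴾ.*-zeroˡ (v b a))

  Unitriangular⇒injective : ∀ {a b} → (∀ k → v a k ≡ v b k) → a ≡ b
  Unitriangular⇒injective {a} {b} va≗vb with a Finᴾ.≟ b
  ... | yes a≡b = a≡b
  ... | no a≢b with triangular a b (a≢b ∘ sym) | triangular b a a≢b
  ...   | inj₁ vba≡0 | _          =
    ⊥-elim (ℚᴾ.1≢0 (trans (sym (one-on-diagonal a)) (trans (va≗vb a) vba≡0)))
  ...   | inj₂ _     | inj₁ vab≡0 =
    ⊥-elim (ℚᴾ.1≢0 (trans (sym (one-on-diagonal b)) (trans (sym (va≗vb b)) vab≡0)))
  ...   | inj₂ rb<ra | inj₂ ra<rb = ⊥-elim (<-asym rb<ra ra<rb)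

data Line : Set where
  row column            : ℕ → Line
  diagonal antidiagonal : Line

-- Coordinate k of M₀ as a line of the grid of size suc m; the tests are those of col, so that
-- col-line holds by computation.
line : ℕ → ℕ → Line
line m k =
  if k <ᵇ suc m then row k
  else if k <ᵇ suc m + m then column (k ∸ suc m)
  else if k ≡ᵇ suc m + m then diagonal
  else antidiagonal

coordinate : ℕ → Line → ℕ
coordinate m (row r)      = r
coordinate m (column c)   = suc m + c
coordinate m diagonal     = suc m + m
coordinate m antidiagonal = suc m + suc m

IsCoordinate : ℕ → Line → Set
IsCoordinate m (row r)      = r < suc m
IsCoordinate m (column c)   = c < m
IsCoordinate m diagonal     = ⊤
IsCoordinate m antidiagonal = ⊤

≡ᵇ-reflects-≡ : ∀ m n → Reflects (m ≡ n) (m ≡ᵇ n)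
≡ᵇ-reflects-≡ m n = fromEquivalence (≡ᵇ⇒≡ m n) (≡⇒≡ᵇ m n)

coordinate-line : ∀ m {k} → k < suc (suc m + suc m) → coordinate m (line m k) ≡ k
coordinate-line m {k} k<2n+1
  with k <ᵇ suc m | <ᵇ-reflects-< k (suc m)
... | true  | _ = refl
... | false | ofⁿ k≮n
  with k <ᵇ suc m + m | <ᵇ-reflects-< k (suc m + m)
...   | true  | _ = m+[n∸m]≡n (≮⇒≥ k≮n)
...   | false | ofⁿ k≮n+m
  with k ≡ᵇ suc m + m | ≡ᵇ-reflects-≡ k (suc m + m)
...     | true  | ofʸ k≡n+m = sym k≡n+m
...     | false | ofⁿ k≢n+m = ≤-antisym n+n≤k (s≤s⁻¹ k<2n+1)
  where
  n+n≤k : suc m + suc m ≤ k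
  n+n≤k = subst (_≤ k) (sym (+-suc (suc m) m)) (≤∧≢⇒< (≮⇒≥ k≮n+m) (k≢n+m ∘ sym))

line-isCoordinate : ∀ m {k} → k < suc (suc m + suc m) → IsCoordinate m (line m k)
line-isCoordinate m {k} _
  with k <ᵇ suc m | <ᵇ-reflects-< k (suc m)
... | true  | ofʸ k<n = k<n
... | false | ofⁿ k≮n
  with k <ᵇ suc m + m | <ᵇ-reflects-< k (suc m + m)
...   | true  | ofʸ k<n+m =
  +-cancelˡ-< (suc m) _ _ (subst (_< suc m + m) (sym (m+[n∸m]≡n (≮⇒≥ k≮n))) k<n+m)
...   | false | _
  with k ≡ᵇ suc m + m
...     | true  = tt
...     | false = tt

line-injective : ∀ m (a b : Fin (suc (suc m + suc m))) → line m (toℕ a) ≡ line m (toℕ b) → a ≡ b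
line-injective m a b la≡lb = Finᴾ.toℕ-injective (begin
  toℕ a                        ≡⟨ sym (coordinate-line m (Finᴾ.toℕ<n a)) ⟩
  coordinate m (line m (toℕ a)) ≡⟨ cong (coordinate m) la≡lb ⟩
  coordinate m (line m (toℕ b)) ≡⟨ coordinate-line m (Finᴾ.toℕ<n b) ⟩
  toℕ b                        ∎)
  where open ≡-Reasoning

incident : ℕ → Line → ℕ × ℕ → Bool
incident m (row r)      (i , j) = r ≡ᵇ i
incident m (column c)   (i , j) = c ≡ᵇ j
incident m diagonal     (i , j) = i ≡ᵇ j
incident m antidiagonal (i , j) = i + j ≡ᵇ m

data Incident (m : ℕ) : Line → ℕ × ℕ → Set where
  on-row          : ∀ {i j} → Incident m (row i) (i , j)
  on-column       : ∀ {i j} → Incident m (column j) (i , j)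
  on-diagonal     : ∀ {i j} → i ≡ j → Incident m diagonal (i , j)
  on-antidiagonal : ∀ {i j} → i + j ≡ m → Incident m antidiagonal (i , j)

incident-sound : ∀ m ℓ c → T (incident m ℓ c) → Incident m ℓ c
incident-sound m (row r) (i , j) r≡ᵇi with ≡ᵇ⇒≡ r i r≡ᵇi
... | refl = on-row
incident-sound m (column c) (i , j) c≡ᵇj with ≡ᵇ⇒≡ c j c≡ᵇj
... | refl = on-column
incident-sound m diagonal     (i , j) i≡ᵇj   = on-diagonal (≡ᵇ⇒≡ i j i≡ᵇj)
incident-sound m antidiagonal (i , j) i+j≡ᵇm = on-antidiagonal (≡ᵇ⇒≡ (i + j) m i+j≡ᵇm)

incident-complete : ∀ {m ℓ c} → Incident m ℓ c → T (incident m ℓ c)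
incident-complete (on-row {i})                = ≡⇒≡ᵇ i i refl
incident-complete (on-column {j = j})         = ≡⇒≡ᵇ j j refl
incident-complete (on-diagonal {i} {j} i≡j)   = ≡⇒≡ᵇ i j i≡j
incident-complete {m} (on-antidiagonal {i} {j} i+j≡m) = ≡⇒≡ᵇ (i + j) m i+j≡m

col-line : ∀ m c (k : Fin (suc (suc m + suc m))) →
           col (suc m) c k ≡ 𝟙 (incident m (line m (toℕ k)) (map toℕ toℕ c))
col-line m c k with toℕ k <ᵇ suc m
... | true  = refl
... | false with toℕ k <ᵇ suc m + m
...   | true  = refl
...   | false with toℕ k ≡ᵇ suc m + m
...     | true  = refl
...     | false = refl

𝟙-incident : ∀ m ℓ c → 𝟙 (incident m ℓ c) ≡ 0ℚ ⊎ Incident m ℓ c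
𝟙-incident m ℓ c with incident m ℓ c | incident-sound m ℓ c
... | false | _     = inj₁ refl
... | true  | sound = inj₂ (sound tt)

𝟙-incident-complete : ∀ {m ℓ c} → Incident m ℓ c → 𝟙 (incident m ℓ c) ≡ 1ℚ
𝟙-incident-complete {m} {ℓ} {c} inc with incident m ℓ c | incident-complete inc
... | true  | _  = refl
... | false | ()

record TriangularSelection (m : ℕ) : Set where
  field
    cell         : Line → ℕ × ℕ
    rank         : Line → ℕ
    cell-bounded : ∀ ℓ → IsCoordinate m ℓ → proj₁ (cell ℓ) < suc m × proj₂ (cell ℓ) < suc m
    cell-on-line : ∀ ℓ → Incident m ℓ (cell ℓ)
    lowest-line  : ∀ ℓ ℓ′ → IsCoordinate m ℓ′ → Incident m ℓ′ (cell ℓ) →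
                   ℓ′ ≡ ℓ ⊎ rank ℓ < rank ℓ′

module _ {m : ℕ} (S : TriangularSelection m) where
  open TriangularSelection S

  selectedCell : Fin (suc (suc m + suc m)) → ℕ × ℕ
  selectedCell a = cell (line m (toℕ a))

  selectedColumn : Fin (suc (suc m + suc m)) → ColIdx (suc m)
  selectedColumn a =
    map (λ i<n → fromℕ< i<n) (λ j<n → fromℕ< j<n)
        (cell-bounded (line m (toℕ a)) (line-isCoordinate m (Finᴾ.toℕ<n a)))

  toℕ-selectedColumn : ∀ a → map toℕ toℕ (selectedColumn a) ≡ selectedCell a
  toℕ-selectedColumn a = cong₂ _,_ (Finᴾ.toℕ-fromℕ< _) (Finᴾ.toℕ-fromℕ< _)

  selectedColumn-entry : ∀ a k →
    col (suc m) (selectedColumn a) k ≡ 𝟙 (incident m (line m (toℕ k)) (selectedCell a))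
  selectedColumn-entry a k =
    trans (col-line m (selectedColumn a) k)
          (cong (𝟙 ∘ incident m (line m (toℕ k))) (toℕ-selectedColumn a))

  selectedColumns-unitriangular : Unitriangular (λ a → col (suc m) (selectedColumn a))
  selectedColumns-unitriangular = record
    { rank            = rank ∘ line m ∘ toℕ
    ; one-on-diagonal = λ a →
        trans (selectedColumn-entry a a) (𝟙-incident-complete (cell-on-line (line m (toℕ a))))
    ; triangular      = triangular
    }
    where
    triangular : ∀ a b → b ≢ a →
      col (suc m) (selectedColumn b) a ≡ 0ℚ ⊎ rank (line m (toℕ b)) < rank (line m (toℕ a))
    triangular a b b≢a with 𝟙-incident m (line m (toℕ a)) (selectedCell b)
    ... | inj₁ entry≡0 = inj₁ (trans (selectedColumn-entry b a) entry≡0)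
    ... | inj₂ incident-ab
      with lowest-line (line m (toℕ b)) (line m (toℕ a))
                       (line-isCoordinate m (Finᴾ.toℕ<n a)) incident-ab
    ...   | inj₁ la≡lb = ⊥-elim (b≢a (line-injective m b a (sym la≡lb)))
    ...   | inj₂ rb<ra = inj₂ rb<ra

RowOwned : ℕ → ℕ × ℕ → Set
RowOwned m (i , j) = i + i ≤ m × (j + j ≤ m → parity i ≡ parity j)

rowOwned? : ∀ m c → Dec (RowOwned m c)
rowOwned? m (i , j) = (i + i ≤? m) ×-dec ((j + j ≤? m) →-dec (parity i ≟ᵖ parity j))

owner : ℕ → ℕ × ℕ → ℕ
owner m (i , j) with rowOwned? m (i , j)
... | yes _ = ⌈ i /2⌉
... | no  _ = ⌈ j /2⌉

owner-row : ∀ {m} i j → RowOwned m (i , j) → owner m (i , j) ≡ ⌈ i /2⌉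
owner-row {m} i j owned with rowOwned? m (i , j)
... | yes _   = refl
... | no  ¬ro = ⊥-elim (¬ro owned)

owner-column : ∀ {m} i j → ¬ RowOwned m (i , j) → owner m (i , j) ≡ ⌈ j /2⌉
owner-column {m} i j ¬owned with rowOwned? m (i , j)
... | yes ro = ⊥-elim (¬owned ro)
... | no  _  = refl

parity[n+n]≡0ℙ : ∀ n → parity (n + n) ≡ 0ℙ
parity[n+n]≡0ℙ zero    = refl
parity[n+n]≡0ℙ (suc n) rewrite +-suc n n = parity[n+n]≡0ℙ n

parity[1+n+n]≡1ℙ : ∀ n → parity (suc (n + n)) ≡ 1ℙ
parity[1+n+n]≡1ℙ zero    = refl
parity[1+n+n]≡1ℙ (suc n) rewrite +-suc n n = parity[1+n+n]≡1ℙ n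

module Block (t : ℕ) where

  A B : ℕ
  A = suc (t + t)
  B = suc A

  withParity : Parity → ℕ
  withParity 1ℙ = A
  withParity 0ℙ = B

  parity-withParity : ∀ p → parity (withParity p) ≡ p
  parity-withParity 1ℙ = parity[1+n+n]≡1ℙ t
  parity-withParity 0ℙ = parity[n+n]≡0ℙ t

  withParity-≢ : ∀ p → withParity p ≢ withParity (p ⁻¹)
  withParity-≢ p eq = p≢p⁻¹ p (begin
    p                          ≡⟨ sym (parity-withParity p) ⟩
    parity (withParity p)      ≡⟨ cong parity eq ⟩
    parity (withParity (p ⁻¹)) ≡⟨ parity-withParity (p ⁻¹) ⟩
    p ⁻¹                       ∎)
    where open ≡-Reasoning

  InBlock : ℕ → Set
  InBlock x = x ≡ A ⊎ x ≡ B

  inBlock? : ∀ x → Dec (InBlock x)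
  inBlock? x = (x ≟ A) ⊎-dec (x ≟ B)

  withParity-inBlock : ∀ p → InBlock (withParity p)
  withParity-inBlock 1ℙ = inj₁ refl
  withParity-inBlock 0ℙ = inj₂ refl

  A∈ : InBlock A
  A∈ = inj₁ refl

  inBlock-≤B : ∀ {x} → InBlock x → x ≤ B
  inBlock-≤B (inj₁ refl) = n≤1+n A
  inBlock-≤B (inj₂ refl) = ≤-refl

  inBlock-≢0 : ∀ {x} → InBlock x → x ≢ 0
  inBlock-≢0 (inj₁ refl) ()
  inBlock-≢0 (inj₂ refl) ()

  inBlock-⌈/2⌉ : ∀ {x} → InBlock x → ⌈ x /2⌉ ≡ suc t
  inBlock-⌈/2⌉ (inj₁ refl) = cong suc (sym (n≡⌊n+n/2⌋ t))
  inBlock-⌈/2⌉ (inj₂ refl) = cong suc (sym (n≡⌈n+n/2⌉ t))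

module Selection (m t : ℕ) (B+B<m : Block.B t + Block.B t < m) where

  open Block t

  inBlock-<m : ∀ {x} → InBlock x → x < m
  inBlock-<m x∈ = ≤-<-trans (≤-trans (inBlock-≤B x∈) (m≤m+n B B)) B+B<m

  inBlock-lower : ∀ {x} → InBlock x → x + x ≤ m
  inBlock-lower x∈ = <⇒≤ (≤-<-trans (+-mono-≤ (inBlock-≤B x∈) (inBlock-≤B x∈)) B+B<m)

  x+x≤m⇒y≤B⇒x+y≢m : ∀ {x y} → x + x ≤ m → y ≤ B → x + y ≢ m
  x+x≤m⇒y≤B⇒x+y≢m {x} {y} x+x≤m y≤B x+y≡m = <⇒≱ B+B<m (begin
    m      ≡⟨ sym x+y≡m ⟩
    x + y  ≤⟨ +-mono-≤ (≤-trans x≤y y≤B) y≤B ⟩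
    B + B  ∎)
    where
    open ≤-Reasoning
    x≤y : x ≤ y
    x≤y = +-cancelˡ-≤ x x y (≤-trans x+x≤m (≤-reflexive (sym x+y≡m)))

  A≤m : A ≤ m
  A≤m = <⇒≤ (inBlock-<m A∈)

  A+A≢m : A + A ≢ m
  A+A≢m = x+x≤m⇒y≤B⇒x+y≢m {A} (inBlock-lower A∈) (inBlock-≤B A∈)

  m-upper : ¬ m + m ≤ m
  m-upper m+m≤m = x+x≤m⇒y≤B⇒x+y≢m m+m≤m z≤n (+-identityʳ m)

  m∸A-upper : ¬ (m ∸ A) + (m ∸ A) ≤ m
  m∸A-upper lower = x+x≤m⇒y≤B⇒x+y≢m lower (inBlock-≤B A∈) (m∸n+n≡m A≤m)

  partner : Parity → ℕ → ℕ
  partner p x with x + withParity p ≟ m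
  ... | yes _ = withParity (p ⁻¹)
  ... | no  _ = withParity p

  partner-inBlock : ∀ p x → InBlock (partner p x)
  partner-inBlock p x with x + withParity p ≟ m
  ... | yes _ = withParity-inBlock (p ⁻¹)
  ... | no  _ = withParity-inBlock p

  partner-off-antidiagonal : ∀ p x → x + partner p x ≢ m
  partner-off-antidiagonal p x with x + withParity p ≟ m
  ... | yes on-p = λ on-p⁻¹ → withParity-≢ p (+-cancelˡ-≡ x _ _ (trans on-p (sym on-p⁻¹)))
  ... | no  off  = off

  partner-parity : ∀ p x → x + x ≤ m → parity (partner p x) ≡ p
  partner-parity p x lower with x + withParity p ≟ m
  ... | yes on = ⊥-elim (x+x≤m⇒y≤B⇒x+y≢m lower (inBlock-≤B (withParity-inBlock p)) on)
  ... | no  _  = parity-withParity p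

  cell : Line → ℕ × ℕ
  cell (row r) with inBlock? r
  ... | yes _ = r , m
  ... | no  _ = r , partner (parity r ⁻¹) r
  cell (column c) with inBlock? c
  ... | yes _ = partner (parity c ⁻¹) c , c
  ... | no  _ = partner (parity c) c , c
  cell diagonal     = A , A
  cell antidiagonal = A , m ∸ A

  rank : Line → ℕ
  rank (row r) with inBlock? r
  ... | yes _ = 4
  ... | no  _ = 2
  rank (column c) with inBlock? c
  ... | yes _ = 3
  ... | no  _ = 2
  rank diagonal     = 0
  rank antidiagonal = 1

  rank-row-inBlock : ∀ {r} → InBlock r → 4 ≤ rank (row r)
  rank-row-inBlock {r} r∈ with inBlock? r
  ... | yes _  = ≤-refl
  ... | no  r∉ = ⊥-elim (r∉ r∈)

  rank-column-inBlock : ∀ {c} → InBlock c → 3 ≤ rank (column c)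
  rank-column-inBlock {c} c∈ with inBlock? c
  ... | yes _  = ≤-refl
  ... | no  c∉ = ⊥-elim (c∉ c∈)

  rank-column : ∀ c → 2 ≤ rank (column c)
  rank-column c with inBlock? c
  ... | yes _ = n≤1+n 2
  ... | no  _ = ≤-refl

  cell-bounded : ∀ ℓ → IsCoordinate m ℓ → proj₁ (cell ℓ) < suc m × proj₂ (cell ℓ) < suc m
  cell-bounded (row r) r<n with inBlock? r
  ... | yes _ = r<n , ≤-refl
  ... | no  _ = r<n , m<n⇒m<1+n (inBlock-<m (partner-inBlock _ r))
  cell-bounded (column c) c<m with inBlock? c
  ... | yes _ = m<n⇒m<1+n (inBlock-<m (partner-inBlock _ c)) , m<n⇒m<1+n c<m
  ... | no  _ = m<n⇒m<1+n (inBlock-<m (partner-inBlock _ c)) , m<n⇒m<1+n c<m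
  cell-bounded diagonal     _ = m<n⇒m<1+n (inBlock-<m A∈) , m<n⇒m<1+n (inBlock-<m A∈)
  cell-bounded antidiagonal _ = m<n⇒m<1+n (inBlock-<m A∈) , s≤s (m∸n≤m m A)

  cell-on-line : ∀ ℓ → Incident m ℓ (cell ℓ)
  cell-on-line (row r) with inBlock? r
  ... | yes _ = on-row
  ... | no  _ = on-row
  cell-on-line (column c) with inBlock? c
  ... | yes _ = on-column
  ... | no  _ = on-column
  cell-on-line diagonal     = on-diagonal refl
  cell-on-line antidiagonal = on-antidiagonal (m+[n∸m]≡n A≤m)

  lowest-line : ∀ ℓ ℓ′ → IsCoordinate m ℓ′ → Incident m ℓ′ (cell ℓ) →
                ℓ′ ≡ ℓ ⊎ rank ℓ < rank ℓ′
  lowest-line (row r) ℓ′ coord inc with inBlock? r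
  lowest-line (row r) _ _ on-row | yes _ = inj₁ refl
  lowest-line (row r) _ m<m on-column | yes _ = ⊥-elim (<-irrefl refl m<m)
  lowest-line (row r) _ _ (on-diagonal r≡m) | yes r∈ = ⊥-elim (<⇒≢ (inBlock-<m r∈) r≡m)
  lowest-line (row r) _ _ (on-antidiagonal r+m≡m) | yes r∈ =
    ⊥-elim (inBlock-≢0 r∈ (+-cancelʳ-≡ m r 0 r+m≡m))
  lowest-line (row r) _ _ on-row | no _ = inj₁ refl
  lowest-line (row r) _ _ on-column | no _ =
    inj₂ (rank-column-inBlock (partner-inBlock _ r))
  lowest-line (row r) _ _ (on-diagonal r≡p) | no r∉ =
    ⊥-elim (r∉ (subst InBlock (sym r≡p) (partner-inBlock _ r)))
  lowest-line (row r) _ _ (on-antidiagonal r+p≡m) | no _ =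
    ⊥-elim (partner-off-antidiagonal _ r r+p≡m)
  lowest-line (column c) ℓ′ coord inc with inBlock? c
  lowest-line (column c) _ _ on-row | yes _ =
    inj₂ (rank-row-inBlock (partner-inBlock _ c))
  lowest-line (column c) _ _ on-column | yes _ = inj₁ refl
  lowest-line (column c) _ _ (on-diagonal p≡c) | yes c∈ = ⊥-elim (p≢p⁻¹ (parity c) (begin
    parity c                          ≡⟨ cong parity (sym p≡c) ⟩
    parity (partner (parity c ⁻¹) c)  ≡⟨ partner-parity (parity c ⁻¹) c (inBlock-lower c∈) ⟩
    parity c ⁻¹                       ∎))
    where open ≡-Reasoning
  lowest-line (column c) _ _ (on-antidiagonal p+c≡m) | yes _ =
    ⊥-elim (partner-off-antidiagonal _ c (trans (+-comm c _) p+c≡m))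
  lowest-line (column c) _ _ on-row | no _ =
    inj₂ (≤-trans (n≤1+n 3) (rank-row-inBlock (partner-inBlock _ c)))
  lowest-line (column c) _ _ on-column | no _ = inj₁ refl
  lowest-line (column c) _ _ (on-diagonal p≡c) | no c∉ =
    ⊥-elim (c∉ (subst InBlock p≡c (partner-inBlock _ c)))
  lowest-line (column c) _ _ (on-antidiagonal p+c≡m) | no _ =
    ⊥-elim (partner-off-antidiagonal _ c (trans (+-comm c _) p+c≡m))
  lowest-line diagonal _ _ on-row                  = inj₂ (≤-trans (s≤s z≤n) (rank-row-inBlock A∈))
  lowest-line diagonal _ _ on-column               = inj₂ (≤-trans (s≤s z≤n) (rank-column-inBlock A∈))
  lowest-line diagonal _ _ (on-diagonal _)         = inj₁ refl
  lowest-line diagonal _ _ (on-antidiagonal A+A≡m) = ⊥-elim (A+A≢m A+A≡m)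
  lowest-line antidiagonal _ _ on-row              =
    inj₂ (≤-trans (s≤s (s≤s z≤n)) (rank-row-inBlock A∈))
  lowest-line antidiagonal _ _ on-column           = inj₂ (rank-column (m ∸ A))
  lowest-line antidiagonal _ _ (on-diagonal A≡m∸A) =
    ⊥-elim (A+A≢m (trans (cong (A +_) A≡m∸A) (m+[n∸m]≡n A≤m)))
  lowest-line antidiagonal _ _ (on-antidiagonal _) = inj₁ refl

  selection : TriangularSelection m
  selection = record
    { cell         = cell
    ; rank         = rank
    ; cell-bounded = cell-bounded
    ; cell-on-line = cell-on-line
    ; lowest-line  = lowest-line
    }

  owner-cell : ∀ ℓ → owner m (cell ℓ) ≡ suc t
  owner-cell (row r) with inBlock? r
  ... | yes r∈ = trans (owner-row r m (inBlock-lower r∈ , ⊥-elim ∘ m-upper)) (inBlock-⌈/2⌉ r∈)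
  ... | no  _  = trans (owner-column r _ not-owned) (inBlock-⌈/2⌉ (partner-inBlock _ r))
    where
    not-owned : ¬ RowOwned m (r , partner (parity r ⁻¹) r)
    not-owned (r-lower , same-parity) = p≢p⁻¹ (parity r)
      (trans (same-parity (inBlock-lower (partner-inBlock _ r))) (partner-parity _ r r-lower))
  owner-cell (column c) with inBlock? c
  ... | yes c∈ = trans (owner-column (partner (parity c ⁻¹) c) c not-owned) (inBlock-⌈/2⌉ c∈)
    where
    not-owned : ¬ RowOwned m (partner (parity c ⁻¹) c , c)
    not-owned (_ , same-parity) = p≢p⁻¹ (parity c)
      (trans (sym (same-parity (inBlock-lower c∈))) (partner-parity _ c (inBlock-lower c∈)))
  ... | no  _  = trans (owner-row (partner (parity c) c) c owned) (inBlock-⌈/2⌉ (partner-inBlock _ c))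
    where
    owned : RowOwned m (partner (parity c) c , c)
    owned = inBlock-lower (partner-inBlock _ c) , partner-parity _ c
  owner-cell diagonal =
    trans (owner-row A A (inBlock-lower A∈ , λ _ → refl)) (inBlock-⌈/2⌉ A∈)
  owner-cell antidiagonal =
    trans (owner-row A (m ∸ A) (inBlock-lower A∈ , ⊥-elim ∘ m∸A-upper)) (inBlock-⌈/2⌉ A∈)

  owner-selectedColumn : ∀ a → owner m (map toℕ toℕ (selectedColumn selection a)) ≡ suc t
  owner-selectedColumn a =
    trans (cong (owner m) (toℕ-selectedColumn selection a)) (owner-cell (line m (toℕ a)))

block-fits : ∀ m t → t < suc m / 4 ∸ 1 → Block.B t + Block.B t < m
block-fits m t t<q∸1 = ≤-trans (m≤n+m _ 2) (≤-pred (begin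
  3 + suc (B + B)  ≡⟨ four-blocks t ⟩
  (2 + t) * 4      ≤⟨ *-monoˡ-≤ 4 (2+t≤q (suc m / 4) t<q∸1) ⟩
  suc m / 4 * 4    ≤⟨ m/n*n≤m (suc m) 4 ⟩
  suc m            ∎))
  where
  open ≤-Reasoning
  open Block t
  four-blocks : ∀ u → 3 + suc (suc (suc (u + u)) + suc (suc (u + u))) ≡ (2 + u) * 4
  four-blocks = solve-∀
  2+t≤q : ∀ q → t < q ∸ 1 → 2 + t ≤ q
  2+t≤q (suc q) t<q = s≤s t<q

theorem2p4 : (n : ℕ) → 8 ≤ n →
    Σ[ D ∈ (Fin (n / 4 ∸ 1) → Fin (suc (n + n)) → ColIdx n) ]
      ((∀ t → Injective _≡_ _≡_ (D t))
      × (∀ t → LinIndep (λ a → col n (D t a)))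
      × (∀ t s a b → D t a ≡ D s b → t ≡ s))
theorem2p4 (suc m) (s≤s _) = D , injective , linIndep , disjoint
  where
  fits : (t : Fin (suc m / 4 ∸ 1)) → Block.B (toℕ t) + Block.B (toℕ t) < m
  fits t = block-fits m (toℕ t) (Finᴾ.toℕ<n t)

  S : Fin (suc m / 4 ∸ 1) → TriangularSelection m
  S t = Selection.selection m (toℕ t) (fits t)

  D : Fin (suc m / 4 ∸ 1) → Fin (suc (suc m + suc m)) → ColIdx (suc m)
  D t = selectedColumn (S t)

  injective : ∀ t → Injective _≡_ _≡_ (D t)
  injective t Dta≡Dtb = Unitriangular⇒injective (selectedColumns-unitriangular (S t))
                          (λ k → cong (λ c → col (suc m) c k) Dta≡Dtb)

  linIndep : ∀ t → LinIndep (λ a → col (suc m) (D t a))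
  linIndep t = Unitriangular⇒LinIndep (selectedColumns-unitriangular (S t))

  owner-D : ∀ t a → owner m (map toℕ toℕ (D t a)) ≡ suc (toℕ t)
  owner-D t = Selection.owner-selectedColumn m (toℕ t) (fits t)

  disjoint : ∀ t s a b → D t a ≡ D s b → t ≡ s
  disjoint t s a b Dta≡Dsb = Finᴾ.toℕ-injective (suc-injective (begin
    suc (toℕ t)                   ≡⟨ sym (owner-D t a) ⟩
    owner m (map toℕ toℕ (D t a)) ≡⟨ cong (owner m ∘ map toℕ toℕ) Dta≡Dsb ⟩
    owner m (map toℕ toℕ (D s b)) ≡⟨ owner-D s b ⟩
    suc (toℕ s)                   ∎))
    where open ≡-Reasoning
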